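{- Let $p$ be a positive integer. Let $g(n,p,p,p)$ be the number of partitions of $n$ in which exactly one part appears at least $p$ times and all other parts appear at most $p-1$ times, and let $g_{o}(n,p,p,p)$ (resp. $g_{e}(n,p,p,p)$) be the number of such partitions in which the part appearing at least $p$ times is odd (resp. even). For $i \in \{0, p\}$, let $h_{i}(n,p)$ be the number of partitions of $n$ in which every part is either not divisible by $p$ or congruent to $i \pmod{2p}$, and the set of (distinct values of) parts congruent to $i \pmod{2p}$ has exactly one element. Then for all $n \geq 0$, $$g_{o}(n,p,p,p) = h_{p}(n,p) \quad\text{and}\quad g_{e}(n,p,p,p) = h_{0}(n,p).$$ -}

module Defs where

open import Data.Nat using (ℕ; zero; suc; _+_; _*_; _∸_; _⊓_; _%_; _≡ᵇ_; _≤ᵇ_)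
open import Data.Bool using (Bool; true; false; not; _∧_; _∨_)
open import Data.List using (List; []; _∷_; length; map; concatMap; applyUpTo; filterᵇ; deduplicateᵇ)

-- Partitions of n are represented as weakly decreasing lists of positive integers
-- summing to n.  `partsF fuel n k` lists all partitions of n whose parts are all
-- at most k (the fuel, initially n, bounds the recursion: every step removes a part ≥ 1).
partsF : ℕ → ℕ → ℕ → List (List ℕ)
partsF _ zero _ = [] ∷ []
partsF zero (suc n) _ = []
partsF (suc f) (suc n) k =
  concatMap (λ j → map (j ∷_) (partsF f (suc n ∸ j) j)) (applyUpTo suc (k ⊓ suc n))

partitions : ℕ → List (List ℕ)
partitions n = partsF n n n

count : (List ℕ → Bool) → ℕ → ℕ
count P n = length (filterᵇ P (partitions n))

-- x mod m (only used with m ≥ 1, where it is the usual remainder)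
mod : ℕ → ℕ → ℕ
mod x zero = x
mod x (suc m) = x % suc m

mult : ℕ → List ℕ → ℕ
mult k λs = length (filterᵇ (k ≡ᵇ_) λs)

heavy : ℕ → List ℕ → List ℕ
heavy p λs = deduplicateᵇ _≡ᵇ_ (filterᵇ (λ x → p ≤ᵇ mult x λs) λs)

-- λ has exactly one part value appearing ≥ p times (all others then appear ≤ p-1
-- times), and that value k satisfies k mod 2 = r
gPred : ℕ → ℕ → List ℕ → Bool
gPred r p λs with heavy p λs
... | k ∷ [] = mod k 2 ≡ᵇ r
... | _ = false

g-o : ℕ → ℕ → ℕ
g-o n p = count (gPred 1 p) n

g-e : ℕ → ℕ → ℕ
g-e n p = count (gPred 0 p) n

allᵇ : (ℕ → Bool) → List ℕ → Bool
allᵇ P [] = true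
allᵇ P (x ∷ xs) = P x ∧ allᵇ P xs

hPred : ℕ → ℕ → List ℕ → Bool
hPred i p λs =
  allᵇ (λ x → not (mod x p ≡ᵇ 0) ∨ (mod x (2 * p) ≡ᵇ i)) λs
  ∧ (length (deduplicateᵇ _≡ᵇ_ (filterᵇ (λ x → mod x (2 * p) ≡ᵇ i) λs)) ≡ᵇ 1)

h : ℕ → ℕ → ℕ → ℕ
h i n p = count (hPred i p) n

-- Glaisher's theorem drives everything: the number R(m) of partitions of m in which every part
-- occurs fewer than p times equals the number D(m) of partitions of m with no part divisible by p.
-- Every partition of n splits uniquely into a partition μ and a remainder ρ ⊢ n − p|μ| of either
-- kind, by writing each multiplicity as (m mod p) + p⌊m/p⌋, or by pulling out the parts divisible
-- by p. Hence Σ_μ R(n − p|μ|) = Σ_μ D(n − p|μ|), and all terms but μ = ∅ agree by strong induction.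
--
-- A partition counted by g_r(n,p,p,p) with heavy part k is determined by k, a = ⌊m_k/p⌋ ≥ 1 and
-- what remains after removing ap copies of k, a partition of n − akp with all multiplicities
-- below p. A partition counted by h_{rp}(n,p) is determined by its unique part value
-- x ≡ rp (mod 2p), i.e. x = kp with k ≡ r (mod 2), its multiplicity a ≥ 1, and the remaining
-- parts, a partition of n − akp with no part divisible by p. So both sides are the same sum
-- over (k , a) of R(n − akp) and D(n − akp) respectively, and Glaisher's theorem matches them.

module Submission where

open import Defs

open import Data.Bool.Base using (Bool; true; false; T; not; _∨_; if_then_else_)
open import Data.Bool.Properties using (T-∧; T-∨)
open import Data.List.Base
  using (List; []; _∷_; [_]; _++_; length; map; filterᵇ; deduplicateᵇ; replicate; concatMap;
         applyUpTo; upTo; cartesianProduct)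
open import Data.List.Properties
  using (∷-injectiveˡ; ∷-injectiveʳ; length-map; length-++; map-∘; map-id-local;
         filter-++; filter-accept; filter-reject; filter-none)
open import Data.List.Membership.Propositional using (_∈_; _∉_; find; lose)
open import Data.List.Membership.Propositional.Properties
  using (∈-length; ∈-map⁺; ∈-map⁻; ∈-filter⁺; ∈-filter⁻; ∈-concatMap⁺; ∈-concatMap⁻;
         ∈-applyUpTo⁺; ∈-applyUpTo⁻; ∈-upTo⁺; ∈-upTo⁻; ∈-deduplicate⁻;
         ∈-cartesianProduct⁺; ∈-cartesianProduct⁻)
open import Data.List.Membership.Propositional.Properties.WithK using (unique∧set⇒bag)
import Data.List.Membership.Setoid.Properties as SetoidMembership
open import Data.List.Relation.Binary.BagAndSetEquality using (∼bag⇒↭)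
open import Data.List.Relation.Binary.Permutation.Propositional using (_↭_; ↭-sym)
open import Data.List.Relation.Binary.Permutation.Propositional.Properties
  using (filter-↭; ↭-length; All-resp-↭)
open import Data.List.Relation.Unary.All as All using (All; []; _∷_)
import Data.List.Relation.Unary.All.Properties as All
open import Data.List.Relation.Unary.All.Properties using (all-filter)
open import Data.List.Relation.Unary.AllPairs as AllPairs using (AllPairs; []; _∷_)
import Data.List.Relation.Unary.AllPairs.Properties as AllPairs
open import Data.List.Relation.Unary.Any using (here; there)
import Data.List.Relation.Unary.Linked as Linked
open Linked using ([]; [-]; _∷_)
open import Data.List.Relation.Unary.Unique.Propositional using (Unique)
import Data.List.Relation.Unary.Unique.Propositional.Properties as Uniqueₚ
open import Data.Nat.Base
open import Data.Nat.Properties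
open import Data.Nat.DivMod
open import Data.Nat.Divisibility using (n∣m*n; m%n≡0⇒n∣m)
open import Data.Nat.Induction using (<-rec)
open import Data.Nat.ListAction using (sum)
open import Data.Nat.ListAction.Properties using (sum-++; sum-↭)
open import Data.Product.Base using (_×_; _,_; proj₁; proj₂; ∃-syntax; uncurry)
open import Data.Sum.Base using (inj₁; inj₂)
open import Function.Base using (_∘_; _∘₂_; case_of_)
open import Function.Bundles using (Equivalence; mk⇔)
open import Relation.Binary.Definitions using (tri<; tri≈; tri>)
open import Relation.Binary.PropositionalEquality
  using (_≡_; _≢_; refl; sym; trans; cong; cong₂; subst; setoid; module ≡-Reasoning)
open import Relation.Binary.Properties.DecTotalOrder ≤-decTotalOrder using (≥-decTotalOrder; ≥-totalOrder)
open import Relation.Nullary.Decidable.Core using (T?; yes; no; ¬?)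
open import Relation.Nullary.Negation.Core using (¬_; contradiction)

open import Data.List.Relation.Unary.Sorted.TotalOrder ≥-totalOrder using (Sorted)
import Data.List.Relation.Unary.Sorted.TotalOrder.Properties as Sorted
open Sorted using (Sorted⇒AllPairs)
open import Data.List.Sort ≥-decTotalOrder using (sort; sort-↭; sort-↗)

T-not⁺ : ∀ {b} → ¬ T b → T (not b)
T-not⁺ {false} _ = _
T-not⁺ {true} ¬b = ¬b _

T-not⁻ : ∀ {b} → T (not b) → ¬ T b
T-not⁻ {false} _ ()

allᵇ⇒All : ∀ P xs → T (allᵇ P xs) → All (T ∘ P) xs
allᵇ⇒All P [] _ = []
allᵇ⇒All P (x ∷ xs) all = let Px , Pxs = Equivalence.to T-∧ all in Px ∷ allᵇ⇒All P xs Pxs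

All⇒allᵇ : ∀ P {xs} → All (T ∘ P) xs → T (allᵇ P xs)
All⇒allᵇ P [] = _
All⇒allᵇ P (Px ∷ Pxs) = Equivalence.from T-∧ (Px , All⇒allᵇ P Pxs)

mod≡% : ∀ x n .{{_ : NonZero n}} → mod x n ≡ x % n
mod≡% x (suc n) = refl

+-≡⇒≡∸ : ∀ {a b n} → a + b ≡ n → b ≤ n × a ≡ n ∸ b
+-≡⇒≡∸ {a} {b} refl = m≤n+m b a , sym (m+n∸n≡m a b)

[r+q*n]%n≡r : ∀ {r n} q .{{_ : NonZero n}} → r < n → (r + q * n) % n ≡ r
[r+q*n]%n≡r {r} {n} q r<n = trans ([m+kn]%n≡m%n r q n) (m<n⇒m%n≡m r<n)

[r+q*n]/n≡q : ∀ {r n} q .{{_ : NonZero n}} → r < n → (r + q * n) / n ≡ q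
[r+q*n]/n≡q {r} {n} q r<n = begin
  (r + q * n) / n   ≡⟨ +-distrib-/-∣ʳ r (n∣m*n q) ⟩
  r / n + q * n / n ≡⟨ cong₂ _+_ (m<n⇒m/n≡0 r<n) (m*n/n≡m q n) ⟩
  q                 ∎
  where open ≡-Reasoning

m%n≡0⇒m/n*n≡m : ∀ {m n} .{{_ : NonZero n}} → m % n ≡ 0 → m / n * n ≡ m
m%n≡0⇒m/n*n≡m {m} {n} m%n≡0 = m/n*n≡m (m%n≡0⇒n∣m m n m%n≡0)


-- Multiplicities

mult-++ : ∀ v xs ys → mult v (xs ++ ys) ≡ mult v xs + mult v ys
mult-++ v xs ys = trans (cong length (filter-++ (T? ∘ (v ≡ᵇ_)) xs ys)) (length-++ (filterᵇ (v ≡ᵇ_) xs))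

mult-↭ : ∀ v {xs ys} → xs ↭ ys → mult v xs ≡ mult v ys
mult-↭ v xs↭ys = ↭-length (filter-↭ _ xs↭ys)

mult-∷-self : ∀ v xs → mult v (v ∷ xs) ≡ suc (mult v xs)
mult-∷-self v xs = cong length (filter-accept (T? ∘ (v ≡ᵇ_)) (≡⇒≡ᵇ v v refl))

mult-∷-other : ∀ v {x} xs → v ≢ x → mult v (x ∷ xs) ≡ mult v xs
mult-∷-other v {x} xs v≢x = cong length (filter-reject (T? ∘ (v ≡ᵇ_)) (v≢x ∘ ≡ᵇ⇒≡ v x))

mult-∷-cong : ∀ v x {xs ys} → mult v xs ≡ mult v ys → mult v (x ∷ xs) ≡ mult v (x ∷ ys)
mult-∷-cong v x {xs} {ys} eq = begin
  mult v (x ∷ xs)         ≡⟨ mult-++ v [ x ] xs ⟩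
  mult v [ x ] + mult v xs ≡⟨ cong (mult v [ x ] +_) eq ⟩
  mult v [ x ] + mult v ys ≡⟨ mult-++ v [ x ] ys ⟨
  mult v (x ∷ ys)         ∎
  where open ≡-Reasoning

mult-replicate-self : ∀ v n → mult v (replicate n v) ≡ n
mult-replicate-self v zero = refl
mult-replicate-self v (suc n) = trans (mult-∷-self v _) (cong suc (mult-replicate-self v n))

mult-replicate-other : ∀ v {x} n → v ≢ x → mult v (replicate n x) ≡ 0
mult-replicate-other v zero v≢x = refl
mult-replicate-other v (suc n) v≢x = trans (mult-∷-other v _ v≢x) (mult-replicate-other v n v≢x)

mult-filter-accept : ∀ (P : ℕ → Bool) {v} xs → T (P v) → mult v (filterᵇ P xs) ≡ mult v xs
mult-filter-accept P [] Pv = refl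
mult-filter-accept P {v} (x ∷ xs) Pv with T? (P x)
... | yes Px = begin
  mult v (filterᵇ P (x ∷ xs)) ≡⟨ cong (mult v) (filter-accept (T? ∘ P) Px) ⟩
  mult v (x ∷ filterᵇ P xs)   ≡⟨ mult-∷-cong v x (mult-filter-accept P xs Pv) ⟩
  mult v (x ∷ xs)             ∎
  where open ≡-Reasoning
... | no ¬Px = begin
  mult v (filterᵇ P (x ∷ xs)) ≡⟨ cong (mult v) (filter-reject (T? ∘ P) ¬Px) ⟩
  mult v (filterᵇ P xs)       ≡⟨ mult-filter-accept P xs Pv ⟩
  mult v xs                   ≡⟨ mult-∷-other v xs (λ { refl → ¬Px Pv }) ⟨
  mult v (x ∷ xs)             ∎
  where open ≡-Reasoning

mult-filter-reject : ∀ (P : ℕ → Bool) {v} xs → ¬ T (P v) → mult v (filterᵇ P xs) ≡ 0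
mult-filter-reject P [] ¬Pv = refl
mult-filter-reject P {v} (x ∷ xs) ¬Pv with T? (P x)
... | yes Px = begin
  mult v (filterᵇ P (x ∷ xs)) ≡⟨ cong (mult v) (filter-accept (T? ∘ P) Px) ⟩
  mult v (x ∷ filterᵇ P xs)   ≡⟨ mult-∷-other v _ (λ { refl → ¬Pv Px }) ⟩
  mult v (filterᵇ P xs)       ≡⟨ mult-filter-reject P xs ¬Pv ⟩
  0                           ∎
  where open ≡-Reasoning
... | no ¬Px = trans (cong (mult v) (filter-reject (T? ∘ P) ¬Px)) (mult-filter-reject P xs ¬Pv)

∈⇒mult>0 : ∀ {v xs} → v ∈ xs → 0 < mult v xs
∈⇒mult>0 {v} v∈xs = ∈-length (∈-filter⁺ (T? ∘ (v ≡ᵇ_)) v∈xs (≡⇒≡ᵇ v v refl))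

mult>0⇒∈ : ∀ v xs → 0 < mult v xs → v ∈ xs
mult>0⇒∈ v (x ∷ xs) pos with v ≟ x
... | yes refl = here refl
... | no v≢x  = there (mult>0⇒∈ v xs (subst (0 <_) (mult-∷-other v xs v≢x) pos))

∉⇒mult≡0 : ∀ v xs → v ∉ xs → mult v xs ≡ 0
∉⇒mult≡0 v xs v∉xs = n≤0⇒n≡0 (≮⇒≥ (v∉xs ∘ mult>0⇒∈ v xs))

mult-∷-cancel : ∀ x {xs ys} → (∀ v → mult v (x ∷ xs) ≡ mult v (x ∷ ys)) → ∀ v → mult v xs ≡ mult v ys
mult-∷-cancel x {xs} {ys} eq v = +-cancelˡ-≡ (mult v [ x ])  (mult v xs) (mult v ys)
  (trans (sym (mult-++ v [ x ] xs)) (trans (eq v) (mult-++ v [ x ] ys)))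

sorted-mult-injective : ∀ {xs ys} → Sorted xs → Sorted ys → (∀ v → mult v xs ≡ mult v ys) → xs ≡ ys
sorted-mult-injective xs↘ ys↘ = go (Sorted⇒AllPairs ≥-totalOrder xs↘) (Sorted⇒AllPairs ≥-totalOrder ys↘)
  where
  Descending : List ℕ → Set
  Descending = AllPairs (λ x y → y ≤ x)

  ∉-above-head : ∀ {x xs v} → All (_≤ x) xs → x < v → v ∉ x ∷ xs
  ∉-above-head x≥xs x<v (here refl)  = <-irrefl refl x<v
  ∉-above-head x≥xs x<v (there v∈xs) = <⇒≱ x<v (All.lookup x≥xs v∈xs)

  larger-head-absent : ∀ {x xs y ys} → All (_≤ x) xs → x < y → mult y (x ∷ xs) ≢ mult y (y ∷ ys)
  larger-head-absent {x} {xs} {y} {ys} x≥xs x<y eq = 0≢1+n (begin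
    0                 ≡⟨ ∉⇒mult≡0 y (x ∷ xs) (∉-above-head x≥xs x<y) ⟨
    mult y (x ∷ xs)   ≡⟨ eq ⟩
    mult y (y ∷ ys)   ≡⟨ mult-∷-self y ys ⟩
    suc (mult y ys)   ∎)
    where open ≡-Reasoning

  go : ∀ {xs ys} → Descending xs → Descending ys → (∀ v → mult v xs ≡ mult v ys) → xs ≡ ys
  go [] [] eq = refl
  go [] (_∷_ {y} {ys} _ _) eq = contradiction (trans (eq y) (mult-∷-self y ys)) 0≢1+n
  go (_∷_ {x} {xs} _ _) [] eq = contradiction (trans (sym (eq x)) (mult-∷-self x xs)) 0≢1+n
  go (_∷_ {x} x≥xs xs↘) (_∷_ {y} y≥ys ys↘) eq with <-cmp x y
  ... | tri< x<y _ _ = contradiction (eq y) (larger-head-absent x≥xs x<y)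
  ... | tri> _ _ y<x = contradiction (sym (eq x)) (larger-head-absent y≥ys y<x)
  ... | tri≈ _ refl _ = cong (x ∷_) (go xs↘ ys↘ (mult-∷-cancel x eq))


-- Partitions and their enumeration

record IsPartition (n : ℕ) (π : List ℕ) : Set where
  field
    sorted   : Sorted π
    positive : All (0 <_) π
    sum≡     : sum π ≡ n

open IsPartition

≤-sum : ∀ xs → All (_≤ sum xs) xs
≤-sum [] = []
≤-sum (x ∷ xs) = m≤m+n x (sum xs) ∷ All.map (λ y≤ → ≤-trans y≤ (m≤n+m (sum xs) x)) (≤-sum xs)

parts≤ : ∀ {n π} → IsPartition n π → All (_≤ n) π
parts≤ {π = π} π⊢n = subst (λ m → All (_≤ m) π) (sum≡ π⊢n) (≤-sum π)

mult-0 : ∀ {n π} → IsPartition n π → mult 0 π ≡ 0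
mult-0 {π = π} π⊢n = ∉⇒mult≡0 0 π (λ 0∈π → <-irrefl refl (All.lookup (positive π⊢n) 0∈π))

mult-> : ∀ {n π v} → IsPartition n π → n < v → mult v π ≡ 0
mult-> {π = π} {v} π⊢n n<v = ∉⇒mult≡0 v π (λ v∈π → <⇒≱ n<v (All.lookup (parts≤ π⊢n) v∈π))

-- Only applied to lists known to be singletons; the value on [] is never used.
theElement : List ℕ → ℕ
theElement [] = 0
theElement (x ∷ _) = x

∷-sorted : ∀ {x xs} → All (_≤ x) xs → Sorted xs → Sorted (x ∷ xs)
∷-sorted [] [] = [-]
∷-sorted (y≤x ∷ _) ys↘ = y≤x ∷ ys↘

partsF-sound : ∀ f n k {π} → π ∈ partsF f n k → IsPartition n π × All (_≤ k) π
partsF-sound f zero k (here refl) = record { sorted = []; positive = []; sum≡ = refl } , []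
partsF-sound (suc f) (suc n) k π∈
  with j , j∈ , π∈′ ← find (∈-concatMap⁻ _ {xs = applyUpTo suc (k ⊓ suc n)} π∈)
  with i , i< , refl ← ∈-applyUpTo⁻ suc j∈
  with ys , ys∈ , refl ← ∈-map⁻ (suc i ∷_) π∈′
  with ys⊢ , ys≤ ← partsF-sound f (n ∸ i) (suc i) ys∈
  = record { sorted = ∷-sorted ys≤ (sorted ys⊢)
           ; positive = z<s ∷ positive ys⊢
           ; sum≡ = trans (cong (suc i +_) (sum≡ ys⊢)) (m+[n∸m]≡n (≤-trans i< (m⊓n≤n k (suc n)))) }
  , ≤-trans i< (m⊓n≤m k (suc n)) ∷ All.map (λ y≤ → ≤-trans y≤ (≤-trans i< (m⊓n≤m k (suc n)))) ys≤

partsF-complete : ∀ f n k {π} → n ≤ f → IsPartition n π → All (_≤ k) π → π ∈ partsF f n k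
partsF-complete f zero k {[]} _ _ _ = here refl
partsF-complete zero (suc n) k {[]} () _ _
partsF-complete (suc f) (suc n) k {[]} _ π⊢n _ = contradiction (sum≡ π⊢n) 0≢1+n
partsF-complete f zero k {x ∷ _} _ π⊢n _ =
  contradiction (m+n≡0⇒m≡0 x (sum≡ π⊢n)) (n>0⇒n≢0 (All.head (positive π⊢n)))
partsF-complete zero (suc n) k {_ ∷ _} () _ _
partsF-complete (suc f) (suc n) k {zero ∷ _} _ π⊢n _ = contradiction (All.head (positive π⊢n)) (<-irrefl refl)
partsF-complete (suc f) (suc n) k {suc i ∷ ys} (s≤s n≤f) π⊢n (j≤k ∷ _) =
  ∈-concatMap⁺ _ (lose (∈-applyUpTo⁺ suc (⊓-glb j≤k j≤1+n)) (∈-map⁺ (suc i ∷_) ys∈))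
  where
  j≤1+n : suc i ≤ suc n
  j≤1+n = subst (suc i ≤_) (sum≡ π⊢n) (m≤m+n (suc i) (sum ys))

  ys-sum : sum ys ≡ n ∸ i
  ys-sum = trans (sym (m+n∸m≡n (suc i) (sum ys))) (cong (_∸ suc i) (sum≡ π⊢n))

  ys⊢ : IsPartition (n ∸ i) ys
  ys⊢ = record { sorted = Linked.tail (sorted π⊢n)
               ; positive = All.tail (positive π⊢n)
               ; sum≡ = ys-sum }

  ys∈ : ys ∈ partsF f (n ∸ i) (suc i)
  ys∈ = partsF-complete f (n ∸ i) (suc i) (≤-trans (m∸n≤m n i) n≤f) ys⊢
          (AllPairs.head (Sorted⇒AllPairs ≥-totalOrder (sorted π⊢n)))

concatMap-unique : ∀ {A B : Set} (key : B → A) {f : A → List B} {xs} →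
                   Unique xs → (∀ x → Unique (f x)) → (∀ {x y} → y ∈ f x → key y ≡ x) →
                   Unique (concatMap f xs)
concatMap-unique key {f} xs! f! key-f = Uniqueₚ.concat⁺
  (All.map⁺ (All.tabulate (λ {x} _ → f! x)))
  (AllPairs.map⁺ {f = f} (AllPairs.map {R = _≢_} disjoint xs!))
  where
  disjoint : ∀ {x x′} → x ≢ x′ → ∀ {y} → ¬ (y ∈ f x × y ∈ f x′)
  disjoint x≢x′ (y∈fx , y∈fx′) = x≢x′ (trans (sym (key-f y∈fx)) (key-f y∈fx′))

partsF-unique : ∀ f n k → Unique (partsF f n k)
partsF-unique f zero k = [] ∷ []
partsF-unique zero (suc n) k = []
partsF-unique (suc f) (suc n) k =
  concatMap-unique theElement {f = λ j → map (j ∷_) (partsF f (suc n ∸ j) j)}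
    (Uniqueₚ.applyUpTo⁺₁ suc (k ⊓ suc n) (λ i<j _ → <⇒≢ (s≤s i<j)))
    (λ j → Uniqueₚ.map⁺ ∷-injectiveʳ (partsF-unique f (suc n ∸ j) j))
    (λ ys∈ → let _ , _ , eq = ∈-map⁻ _ ys∈ in cong theElement eq)

∈-partitions⁺ : ∀ {n π} → IsPartition n π → π ∈ partitions n
∈-partitions⁺ {n} π⊢n = partsF-complete n n n ≤-refl π⊢n (parts≤ π⊢n)

∈-partitions⁻ : ∀ {n π} → π ∈ partitions n → IsPartition n π
∈-partitions⁻ {n} = proj₁ ∘ partsF-sound n n n

partitions-unique : ∀ n → Unique (partitions n)
partitions-unique n = partsF-unique n n n


-- Counting by decomposition

length-bijection : ∀ {A B : Set} {xs : List A} {ys : List B} (f : A → B) (g : B → A) →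
                   Unique xs → Unique ys →
                   (∀ {x} → x ∈ xs → f x ∈ ys) → (∀ {y} → y ∈ ys → g y ∈ xs) →
                   (∀ {x} → x ∈ xs → g (f x) ≡ x) → (∀ {y} → y ∈ ys → f (g y) ≡ y) →
                   length xs ≡ length ys
length-bijection {xs = xs} {ys} f g xs! ys! f∈ g∈ gf fg = begin
  length xs         ≡⟨ length-map f xs ⟨
  length (map f xs) ≡⟨ ↭-length (∼bag⇒↭ (unique∧set⇒bag fxs! ys! (mk⇔ to from))) ⟩
  length ys         ∎
  where
  open ≡-Reasoning
  gfxs≡xs : map g (map f xs) ≡ xs
  gfxs≡xs = trans (sym (map-∘ xs)) (map-id-local (All.tabulate gf))

  fxs! : Unique (map f xs)
  fxs! = Uniqueₚ.map⁻ (subst Unique (sym gfxs≡xs) xs!)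

  to : ∀ {y} → y ∈ map f xs → y ∈ ys
  to y∈ with x , x∈ , refl ← ∈-map⁻ f y∈ = f∈ x∈

  from : ∀ {y} → y ∈ ys → y ∈ map f xs
  from y∈ = subst (_∈ map f xs) (fg y∈) (∈-map⁺ f (g∈ y∈))

module _ {I : Set} (w : I → ℕ) (is : List I) (X : List ℕ → Bool) (n : ℕ) where

  splittings : List (I × List ℕ)
  splittings = concatMap (λ i → map (i ,_) (filterᵇ X (partitions (n ∸ w i)))) (filterᵇ (λ i → w i ≤ᵇ n) is)

  IsSplitting : I × List ℕ → Set
  IsSplitting (i , ρ) = i ∈ is × w i ≤ n × IsPartition (n ∸ w i) ρ × T (X ρ)

  ∈-splittings⁺ : ∀ {iρ} → IsSplitting iρ → iρ ∈ splittings
  ∈-splittings⁺ (i∈ , i≤ , ρ⊢ , Xρ) =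
    ∈-concatMap⁺ _ (lose (∈-filter⁺ (T? ∘ (λ i → w i ≤ᵇ n)) i∈ (≤⇒≤ᵇ i≤))
                         (∈-map⁺ _ (∈-filter⁺ (T? ∘ X) (∈-partitions⁺ ρ⊢) Xρ)))

  ∈-splittings⁻ : ∀ {iρ} → iρ ∈ splittings → IsSplitting iρ
  ∈-splittings⁻ iρ∈
    with i , i∈ , iρ∈′ ← find (∈-concatMap⁻ _ {xs = filterᵇ (λ i → w i ≤ᵇ n) is} iρ∈)
    with ρ , ρ∈ , refl ← ∈-map⁻ _ iρ∈′
    with i∈is , i≤ ← ∈-filter⁻ (T? ∘ (λ i → w i ≤ᵇ n)) i∈
    with ρ∈′ , Xρ ← ∈-filter⁻ (T? ∘ X) ρ∈
    = i∈is , ≤ᵇ⇒≤ (w i) n i≤ , ∈-partitions⁻ ρ∈′ , Xρ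

  splittings-unique : Unique is → Unique splittings
  splittings-unique is! = concatMap-unique proj₁ (Uniqueₚ.filter⁺ _ is!)
    (λ i → Uniqueₚ.map⁺ (λ { refl → refl }) (Uniqueₚ.filter⁺ _ (partitions-unique (n ∸ w i))))
    (λ iρ∈ → let _ , _ , eq = ∈-map⁻ _ iρ∈ in cong proj₁ eq)

length-splittings-∷ : ∀ {I : Set} (w : I → ℕ) i is X n →
  length (splittings w (i ∷ is) X n) ≡ (if w i ≤ᵇ n then count X (n ∸ w i) else 0) + length (splittings w is X n)
length-splittings-∷ w i is X n with w i ≤ᵇ n
... | true  = trans (length-++ (map (i ,_) (filterᵇ X (partitions (n ∸ w i)))))
                    (cong (_+ length (splittings w is X n)) (length-map (i ,_) (filterᵇ X (partitions (n ∸ w i)))))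
... | false = refl

length-splittings-cong : ∀ {I : Set} (w : I → ℕ) is {X Y} n →
  (∀ {i} → i ∈ is → w i ≤ n → count X (n ∸ w i) ≡ count Y (n ∸ w i)) →
  length (splittings w is X n) ≡ length (splittings w is Y n)
length-splittings-cong w [] n eq = refl
length-splittings-cong w (i ∷ is) {X} {Y} n eq = begin
  length (splittings w (i ∷ is) X n)          ≡⟨ length-splittings-∷ w i is X n ⟩
  term X + length (splittings w is X n)       ≡⟨ cong₂ _+_ term-eq (length-splittings-cong w is n (eq ∘ there)) ⟩
  term Y + length (splittings w is Y n)       ≡⟨ length-splittings-∷ w i is Y n ⟨
  length (splittings w (i ∷ is) Y n)          ∎
  where
  open ≡-Reasoning
  term : (List ℕ → Bool) → ℕ
  term Z = if w i ≤ᵇ n then count Z (n ∸ w i) else 0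
  term-eq : term X ≡ term Y
  term-eq with w i ≤ᵇ n in fits
  ... | true  = eq (here refl) (≤ᵇ⇒≤ (w i) n (subst T (sym fits) _))
  ... | false = refl

record Decomposition (P : List ℕ → Bool) {I : Set} (w : I → ℕ) (is : List I) (X : List ℕ → Bool) (n : ℕ) :
                     Set where
  field
    split       : List ℕ → I × List ℕ
    join        : I × List ℕ → List ℕ
    split-valid : ∀ {π} → IsPartition n π → T (P π) → IsSplitting w is X n (split π)
    join-valid  : ∀ {iρ} → IsSplitting w is X n iρ → IsPartition n (join iρ) × T (P (join iρ))
    join∘split  : ∀ {π} → IsPartition n π → T (P π) → join (split π) ≡ π
    split∘join  : ∀ {iρ} → IsSplitting w is X n iρ → split (join iρ) ≡ iρ

count-decomposition : ∀ {P I} {w : I → ℕ} {is X n} → Unique is → Decomposition P w is X n →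
                      count P n ≡ length (splittings w is X n)
count-decomposition {P} {w = w} {is} {X} {n} is! D = length-bijection split join
  (Uniqueₚ.filter⁺ _ (partitions-unique n)) (splittings-unique w is X n is!)
  (∈-splittings⁺ w is X n ∘ uncurry split-valid ∘ valid)
  (λ iρ∈ → let π⊢ , Pπ = join-valid (∈-splittings⁻ w is X n iρ∈) in
           ∈-filter⁺ (T? ∘ P) (∈-partitions⁺ π⊢) Pπ)
  (uncurry join∘split ∘ valid)
  (split∘join ∘ ∈-splittings⁻ w is X n)
  where
  open Decomposition D
  valid : ∀ {π} → π ∈ filterᵇ P (partitions n) → IsPartition n π × T (P π)
  valid π∈ = let π∈′ , Pπ = ∈-filter⁻ (T? ∘ P) π∈ in ∈-partitions⁻ π∈′ , Pπ


-- Assembling partitions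

mult-sort-++ : ∀ v xs ys → mult v (sort (xs ++ ys)) ≡ mult v xs + mult v ys
mult-sort-++ v xs ys = trans (mult-↭ v (sort-↭ (xs ++ ys))) (mult-++ v xs ys)

sum-sort-++ : ∀ xs ys → sum (sort (xs ++ ys)) ≡ sum xs + sum ys
sum-sort-++ xs ys = trans (sum-↭ (sort-↭ (xs ++ ys))) (sum-++ xs ys)

remainder-isPartition : ∀ {n w ρ ys} → IsPartition n (sort (ρ ++ ys)) → sum ys ≡ w → Sorted ρ → All (0 <_) ρ →
                        w ≤ n × IsPartition (n ∸ w) ρ
remainder-isPartition {n} {w} {ρ} {ys} π⊢n sum-ys ρ↘ ρ>0 =
  let w≤n , sum≡n∸w = +-≡⇒≡∸ sums in w≤n , record { sorted = ρ↘ ; positive = ρ>0 ; sum≡ = sum≡n∸w }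
  where
  open ≡-Reasoning
  sums : sum ρ + w ≡ n
  sums = begin
    sum ρ + w              ≡⟨ cong (sum ρ +_) sum-ys ⟨
    sum ρ + sum ys         ≡⟨ sum-sort-++ ρ ys ⟨
    sum (sort (ρ ++ ys))   ≡⟨ sum≡ π⊢n ⟩
    n                      ∎

join-isPartition : ∀ {n w ρ ys} → IsPartition (n ∸ w) ρ → All (0 <_) ys → sum ys ≡ w → w ≤ n →
                   IsPartition n (sort (ρ ++ ys))
join-isPartition {n} {w} {ρ} {ys} ρ⊢ ys>0 sum-ys w≤n = record
  { sorted   = sort-↗ (ρ ++ ys)
  ; positive = All-resp-↭ (↭-sym (sort-↭ (ρ ++ ys))) (All.++⁺ (positive ρ⊢) ys>0)
  ; sum≡     = begin
      sum (sort (ρ ++ ys)) ≡⟨ sum-sort-++ ρ ys ⟩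
      sum ρ + sum ys       ≡⟨ cong₂ _+_ (sum≡ ρ⊢) sum-ys ⟩
      n ∸ w + w            ≡⟨ m∸n+n≡m w≤n ⟩
      n                    ∎ }
  where open ≡-Reasoning

sum-replicate : ∀ k x → sum (replicate k x) ≡ k * x
sum-replicate zero x = refl
sum-replicate (suc k) x = cong (x +_) (sum-replicate k x)

without : ℕ → List ℕ → List ℕ
without k = filterᵇ (λ y → not (y ≡ᵇ k))

mult-without-self : ∀ k xs → mult k (without k xs) ≡ 0
mult-without-self k xs = mult-filter-reject _ {k} xs (λ k≢k → T-not⁻ k≢k (≡⇒≡ᵇ k k refl))

mult-without-other : ∀ {v k} xs → v ≢ k → mult v (without k xs) ≡ mult v xs
mult-without-other {v} {k} xs v≢k = mult-filter-accept _ {v} xs (T-not⁺ (v≢k ∘ ≡ᵇ⇒≡ v k))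

without-sorted : ∀ k {xs} → Sorted xs → Sorted (without k xs)
without-sorted k = Sorted.filter⁺ ≥-totalOrder (T? ∘ (λ y → not (y ≡ᵇ k)))

addParts : ℕ → ℕ → List ℕ → List ℕ
addParts c k xs = sort (xs ++ replicate c k)

mult-addParts-self : ∀ c k xs → mult k (addParts c k xs) ≡ mult k xs + c
mult-addParts-self c k xs = trans (mult-sort-++ k xs (replicate c k)) (cong (mult k xs +_) (mult-replicate-self k c))

mult-addParts-other : ∀ {v} c k xs → v ≢ k → mult v (addParts c k xs) ≡ mult v xs
mult-addParts-other {v} c k xs v≢k = begin
  mult v (addParts c k xs)              ≡⟨ mult-sort-++ v xs (replicate c k) ⟩
  mult v xs + mult v (replicate c k)    ≡⟨ cong (mult v xs +_) (mult-replicate-other v c v≢k) ⟩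
  mult v xs + 0                         ≡⟨ +-identityʳ (mult v xs) ⟩
  mult v xs                             ∎
  where open ≡-Reasoning

addParts-positive : ∀ c {k xs} → All (0 <_) xs → 0 < k → All (0 <_) (addParts c k xs)
addParts-positive c {k} {xs} xs>0 k>0 =
  All-resp-↭ (↭-sym (sort-↭ (xs ++ replicate c k))) (All.++⁺ xs>0 (All.replicate⁺ c k>0))

fromMult : (ℕ → ℕ) → ℕ → List ℕ
fromMult f zero = []
fromMult f (suc N) = addParts (f (suc N)) (suc N) (fromMult f N)

fromMult-isPartition : ∀ f N → IsPartition (sum (fromMult f N)) (fromMult f N)
fromMult-isPartition f N = record { sorted = sorted′ N ; positive = positive′ N ; sum≡ = refl }
  where
  sorted′ : ∀ N → Sorted (fromMult f N)
  sorted′ zero = []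
  sorted′ (suc N) = sort-↗ _
  positive′ : ∀ N → All (0 <_) (fromMult f N)
  positive′ zero = []
  positive′ (suc N) = addParts-positive (f (suc N)) (positive′ N) z<s

mult-fromMult-above : ∀ f {N v} → N < v → mult v (fromMult f N) ≡ 0
mult-fromMult-above f {zero} N<v = refl
mult-fromMult-above f {suc N} N<v =
  trans (mult-addParts-other (f (suc N)) (suc N) (fromMult f N) (>⇒≢ N<v)) (mult-fromMult-above f (<⇒≤ N<v))

mult-fromMult-within : ∀ f {N v} → 0 < v → v ≤ N → mult v (fromMult f N) ≡ f v
mult-fromMult-within f {zero} {suc v} v>0 ()
mult-fromMult-within f {suc N} {v} v>0 v≤1+N with v ≟ suc N
... | yes refl = trans (mult-addParts-self (f v) v (fromMult f N)) (cong (_+ f v) (mult-fromMult-above f {N} ≤-refl))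
... | no v≢1+N = trans (mult-addParts-other (f (suc N)) (suc N) (fromMult f N) v≢1+N)
                       (mult-fromMult-within f v>0 (≤-pred (≤∧≢⇒< v≤1+N v≢1+N)))

mult-fromMult : ∀ f N → f 0 ≡ 0 → (∀ {v} → N < v → f v ≡ 0) → ∀ v → mult v (fromMult f N) ≡ f v
mult-fromMult f N f0 f>N zero = trans (mult-0 (fromMult-isPartition f N)) (sym f0)
mult-fromMult f N f0 f>N (suc v) with suc v ≤? N
... | yes v<N = mult-fromMult-within f z<s v<N
... | no  v≮N = trans (mult-fromMult-above f (≰⇒> v≮N)) (sym (f>N (≰⇒> v≮N)))

mult-fromMult-of : ∀ (φ : ℕ → ℕ) {n π} → φ 0 ≡ 0 → IsPartition n π →
                   ∀ v → mult v (fromMult (λ u → φ (mult u π)) n) ≡ φ (mult v π)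
mult-fromMult-of φ φ0 π⊢n =
  mult-fromMult _ _ (trans (cong φ (mult-0 π⊢n)) φ0) (λ n<v → trans (cong φ (mult-> π⊢n n<v)) φ0)

fromMult-of-≡ : ∀ (φ : ℕ → ℕ) {n π μ} → φ 0 ≡ 0 → IsPartition n π → Sorted μ →
                (∀ v → φ (mult v π) ≡ mult v μ) → fromMult (λ u → φ (mult u π)) n ≡ μ
fromMult-of-≡ φ {n} {π} φ0 π⊢n μ↘ eq =
  sorted-mult-injective (sorted (fromMult-isPartition (λ u → φ (mult u π)) n)) μ↘
    (λ v → trans (mult-fromMult-of φ φ0 π⊢n v) (eq v))

copies : ℕ → List ℕ → List ℕ
copies k = concatMap (replicate k)

mult-copies : ∀ v k xs → mult v (copies k xs) ≡ mult v xs * k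
mult-copies v k [] = refl
mult-copies v k (x ∷ xs) with v ≟ x
... | yes refl = begin
  mult v (replicate k v ++ copies k xs)          ≡⟨ mult-++ v (replicate k v) (copies k xs) ⟩
  mult v (replicate k v) + mult v (copies k xs)  ≡⟨ cong₂ _+_ (mult-replicate-self v k) (mult-copies v k xs) ⟩
  k + mult v xs * k                              ≡⟨ cong (_* k) (mult-∷-self v xs) ⟨
  mult v (v ∷ xs) * k                            ∎
  where open ≡-Reasoning
... | no v≢x = begin
  mult v (replicate k x ++ copies k xs)          ≡⟨ mult-++ v (replicate k x) (copies k xs) ⟩
  mult v (replicate k x) + mult v (copies k xs)  ≡⟨ cong₂ _+_ (mult-replicate-other v k v≢x) (mult-copies v k xs) ⟩
  mult v xs * k                                  ≡⟨ cong (_* k) (mult-∷-other v xs v≢x) ⟨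
  mult v (x ∷ xs) * k                            ∎
  where open ≡-Reasoning

sum-copies : ∀ k xs → sum (copies k xs) ≡ sum xs * k
sum-copies k [] = refl
sum-copies k (x ∷ xs) = begin
  sum (replicate k x ++ copies k xs)     ≡⟨ sum-++ (replicate k x) (copies k xs) ⟩
  sum (replicate k x) + sum (copies k xs) ≡⟨ cong₂ _+_ (trans (sum-replicate k x) (*-comm k x)) (sum-copies k xs) ⟩
  x * k + sum xs * k                     ≡⟨ *-distribʳ-+ k x (sum xs) ⟨
  (x + sum xs) * k                       ∎
  where open ≡-Reasoning

copies-positive : ∀ k {xs} → All (0 <_) xs → All (0 <_) (copies k xs)
copies-positive k [] = []
copies-positive k (x>0 ∷ xs>0) = All.++⁺ (All.replicate⁺ k x>0) (copies-positive k xs>0)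

sum-map-* : ∀ k xs → sum (map (_* k) xs) ≡ sum xs * k
sum-map-* k [] = refl
sum-map-* k (x ∷ xs) = trans (cong (x * k +_) (sum-map-* k xs)) (sym (*-distribʳ-+ k x (sum xs)))

mult-map-injective : ∀ (f : ℕ → ℕ) → (∀ {x y} → f x ≡ f y → x ≡ y) →
                     ∀ u xs → mult (f u) (map f xs) ≡ mult u xs
mult-map-injective f f-inj u [] = refl
mult-map-injective f f-inj u (x ∷ xs) with u ≟ x
... | yes refl = trans (mult-∷-self (f u) _)
                       (trans (cong suc (mult-map-injective f f-inj u xs)) (sym (mult-∷-self u xs)))
... | no u≢x = trans (mult-∷-other (f u) _ (u≢x ∘ f-inj))
                     (trans (mult-map-injective f f-inj u xs) (sym (mult-∷-other u xs u≢x)))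

mult-map-∉-image : ∀ (f : ℕ → ℕ) {v} → (∀ x → v ≢ f x) → ∀ xs → mult v (map f xs) ≡ 0
mult-map-∉-image f v∉ [] = refl
mult-map-∉-image f {v} v∉ (x ∷ xs) = trans (mult-∷-other v _ (v∉ x)) (mult-map-∉-image f v∉ xs)


-- Glaisher's theorem

partitionsUpTo : ℕ → List (List ℕ)
partitionsUpTo n = concatMap partitions (upTo (suc n))

∈-partitionsUpTo⁺ : ∀ {n μ} → IsPartition (sum μ) μ → sum μ ≤ n → μ ∈ partitionsUpTo n
∈-partitionsUpTo⁺ μ⊢ μ≤n = ∈-concatMap⁺ partitions (lose (∈-upTo⁺ (s≤s μ≤n)) (∈-partitions⁺ μ⊢))

∈-partitionsUpTo⁻ : ∀ {n μ} → μ ∈ partitionsUpTo n → IsPartition (sum μ) μ × sum μ ≤ n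
∈-partitionsUpTo⁻ {n} μ∈ with t , t∈ , μ∈′ ← find (∈-concatMap⁻ partitions {xs = upTo (suc n)} μ∈) =
  let μ⊢ = ∈-partitions⁻ μ∈′ in
  subst (λ t → IsPartition t _) (sym (sum≡ μ⊢)) μ⊢ , subst (_≤ n) (sym (sum≡ μ⊢)) (≤-pred (∈-upTo⁻ t∈))

partitionsUpTo-unique : ∀ n → Unique (partitionsUpTo n)
partitionsUpTo-unique n = concatMap-unique sum (Uniqueₚ.upTo⁺ (suc n)) partitions-unique (sum≡ ∘ ∈-partitions⁻)

multsBelow : ℕ → List ℕ → Bool
multsBelow p π = allᵇ (λ x → mult x π <ᵇ p) π

indivisibleBy : ℕ → ℕ → Bool
indivisibleBy p x = not (mod x p ≡ᵇ 0)

indivisible : ℕ → List ℕ → Bool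
indivisible p π = allᵇ (indivisibleBy p) π

weight : ℕ → List ℕ → ℕ
weight p μ = sum μ * p

module _ {p : ℕ} .{{_ : NonZero p}} where

  multsBelow⁺ : ∀ {π} → (∀ v → mult v π < p) → T (multsBelow p π)
  multsBelow⁺ {π} mult<p = All⇒allᵇ _ {π} (All.tabulate (λ {x} _ → <⇒<ᵇ (mult<p x)))

  multsBelow⁻ : ∀ {π} → T (multsBelow p π) → ∀ v → mult v π < p
  multsBelow⁻ {π} below v with 0 <? mult v π
  ... | yes v-occurs = <ᵇ⇒< _ _ (All.lookup (allᵇ⇒All _ π below) (mult>0⇒∈ v π v-occurs))
  ... | no  v-absent = subst (_< p) (sym (n≤0⇒n≡0 (≮⇒≥ v-absent))) (>-nonZero⁻¹ p)

  indivisibleBy⁺ : ∀ {x} → x % p ≢ 0 → T (indivisibleBy p x)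
  indivisibleBy⁺ {x} x%p≢0 = T-not⁺ (x%p≢0 ∘ trans (sym (mod≡% x p)) ∘ ≡ᵇ⇒≡ _ 0)

  indivisibleBy⁻ : ∀ {x} → T (indivisibleBy p x) → x % p ≢ 0
  indivisibleBy⁻ {x} indiv x%p≡0 = T-not⁻ indiv (≡⇒≡ᵇ _ 0 (trans (mod≡% x p) x%p≡0))

  indivisible⁻ : ∀ {π x} → T (indivisible p π) → x ∈ π → x % p ≢ 0
  indivisible⁻ {π} indiv x∈π = indivisibleBy⁻ (All.lookup (allᵇ⇒All _ π indiv) x∈π)

  mult-indivisible : ∀ {ρ v} → T (indivisible p ρ) → v % p ≡ 0 → mult v ρ ≡ 0
  mult-indivisible {ρ} {v} ρ-indiv v%p≡0 =
    ∉⇒mult≡0 v ρ (λ v∈ρ → indivisible⁻ {π = ρ} ρ-indiv v∈ρ v%p≡0)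

module _ (p : ℕ) .{{_ : NonZero p}} (n : ℕ) where

  private
    Splits : List ℕ × List ℕ → Set
    Splits = IsSplitting (weight p) (partitionsUpTo n) (multsBelow p) n

    quotient remainder : List ℕ → List ℕ
    quotient  π = fromMult (λ v → mult v π / p) n
    remainder π = fromMult (λ v → mult v π % p) n

    divide : List ℕ → List ℕ × List ℕ
    divide π = quotient π , remainder π

    combine : List ℕ × List ℕ → List ℕ
    combine (μ , ρ) = sort (ρ ++ copies p μ)

    mult-combine : ∀ v μ ρ → mult v (combine (μ , ρ)) ≡ mult v ρ + mult v μ * p
    mult-combine v μ ρ = trans (mult-sort-++ v ρ (copies p μ)) (cong (mult v ρ +_) (mult-copies v p μ))

    mult-quotient : ∀ {π} → IsPartition n π → ∀ v → mult v (quotient π) ≡ mult v π / p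
    mult-quotient = mult-fromMult-of (_/ p) (0/n≡0 p)

    mult-remainder : ∀ {π} → IsPartition n π → ∀ v → mult v (remainder π) ≡ mult v π % p
    mult-remainder = mult-fromMult-of (_% p) (m*n%n≡0 0 p)

    combine∘divide : ∀ {π} → IsPartition n π → combine (divide π) ≡ π
    combine∘divide {π} π⊢n = sorted-mult-injective (sort-↗ (remainder π ++ copies p (quotient π))) (sorted π⊢n) λ v →
      begin
      mult v (combine (divide π))                     ≡⟨ mult-combine v (quotient π) (remainder π) ⟩
      mult v (remainder π) + mult v (quotient π) * p  ≡⟨ cong₂ (λ r q → r + q * p) (mult-remainder π⊢n v)
                                                                                   (mult-quotient π⊢n v) ⟩
      mult v π % p + mult v π / p * p                 ≡⟨ m≡m%n+[m/n]*n (mult v π) p ⟨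
      mult v π                                        ∎
      where open ≡-Reasoning

    divide-splits : ∀ {π} → IsPartition n π → Splits (divide π)
    divide-splits {π} π⊢n =
      ∈-partitionsUpTo⁺ (fromMult-isPartition _ n) (≤-trans (m≤m*n (sum (quotient π)) p) w≤n) , w≤n , ρ⊢ ,
      multsBelow⁺ {π = remainder π} (λ v → subst (_< p) (sym (mult-remainder π⊢n v)) (m%n<n (mult v π) p))
      where
      ρ-isPartition = fromMult-isPartition (λ v → mult v π % p) n
      split = remainder-isPartition (subst (IsPartition n) (sym (combine∘divide π⊢n)) π⊢n) (sum-copies p (quotient π))
                                    (sorted ρ-isPartition) (positive ρ-isPartition)
      w≤n = proj₁ split
      ρ⊢  = proj₂ split

    combine-isPartition : ∀ {μρ} → Splits μρ → IsPartition n (combine μρ)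
    combine-isPartition {μ , ρ} (μ∈ , w≤n , ρ⊢ , _) =
      join-isPartition ρ⊢ (copies-positive p (positive (proj₁ (∈-partitionsUpTo⁻ {n} μ∈)))) (sum-copies p μ) w≤n

    divide∘combine : ∀ {μρ} → Splits μρ → divide (combine μρ) ≡ μρ
    divide∘combine {μ , ρ} splits@(μ∈ , _ , ρ⊢ , ρ-below) = cong₂ _,_
      (fromMult-of-≡ (_/ p) (0/n≡0 p) π⊢n (sorted (proj₁ (∈-partitionsUpTo⁻ {n} μ∈)))
        λ v → trans (cong (_/ p) (mult-combine v μ ρ)) ([r+q*n]/n≡q (mult v μ) (ρ<p v)))
      (fromMult-of-≡ (_% p) (m*n%n≡0 0 p) π⊢n (sorted ρ⊢)
        λ v → trans (cong (_% p) (mult-combine v μ ρ)) ([r+q*n]%n≡r (mult v μ) (ρ<p v)))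
      where
      π⊢n = combine-isPartition splits
      ρ<p = multsBelow⁻ {π = ρ} ρ-below

  multsBelow-decomposition : Decomposition (λ _ → true) (weight p) (partitionsUpTo n) (multsBelow p) n
  multsBelow-decomposition = record
    { split       = divide
    ; join        = combine
    ; split-valid = λ π⊢n _ → divide-splits π⊢n
    ; join-valid  = λ splits → combine-isPartition splits , _
    ; join∘split  = λ π⊢n _ → combine∘divide π⊢n
    ; split∘join  = divide∘combine }

module _ (p : ℕ) .{{_ : NonZero p}} (n : ℕ) where

  private
    Splits : List ℕ × List ℕ → Set
    Splits = IsSplitting (weight p) (partitionsUpTo n) (indivisible p) n

    multiples indivisibles : List ℕ → List ℕ
    multiples   π = fromMult (λ u → mult (u * p) π) n
    indivisibles  = filterᵇ (indivisibleBy p)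

    divide : List ℕ → List ℕ × List ℕ
    divide π = multiples π , indivisibles π

    combine : List ℕ × List ℕ → List ℕ
    combine (μ , ρ) = sort (ρ ++ map (_* p) μ)

    mult-scaled : ∀ u μ → mult (u * p) (map (_* p) μ) ≡ mult u μ
    mult-scaled = mult-map-injective (_* p) (*-cancelʳ-≡ _ _ p)

    mult-scaled-indivisible : ∀ {v} → v % p ≢ 0 → ∀ μ → mult v (map (_* p) μ) ≡ 0
    mult-scaled-indivisible v%p≢0 =
      mult-map-∉-image (_* p) (λ x v≡xp → v%p≢0 (trans (cong (_% p) v≡xp) (m*n%n≡0 x p)))

    mult-multiples : ∀ {π} → IsPartition n π → ∀ u → mult u (multiples π) ≡ mult (u * p) π
    mult-multiples π⊢n = mult-fromMult _ _ (mult-0 π⊢n) (λ n<u → mult-> π⊢n (<-≤-trans n<u (m≤m*n _ p)))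

    mult-indivisibles : ∀ {v} π → v % p ≢ 0 → mult v (indivisibles π) ≡ mult v π
    mult-indivisibles π v%p≢0 = mult-filter-accept (indivisibleBy p) π (indivisibleBy⁺ v%p≢0)

    mult-indivisibles-divisible : ∀ {v} π → v % p ≡ 0 → mult v (indivisibles π) ≡ 0
    mult-indivisibles-divisible π v%p≡0 = mult-filter-reject (indivisibleBy p) π (λ indiv → indivisibleBy⁻ indiv v%p≡0)

    indivisibles-sorted : ∀ {π} → Sorted π → Sorted (indivisibles π)
    indivisibles-sorted = Sorted.filter⁺ ≥-totalOrder (T? ∘ indivisibleBy p)

    combine∘divide : ∀ {π} → IsPartition n π → combine (divide π) ≡ π
    combine∘divide {π} π⊢n = sorted-mult-injective (sort-↗ (ρ ++ map (_* p) μ)) (sorted π⊢n) mult-eq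
      where
      μ = multiples π
      ρ = indivisibles π
      open ≡-Reasoning
      mult-eq : ∀ v → mult v (combine (μ , ρ)) ≡ mult v π
      mult-eq v with v % p ≟ 0
      ... | no v%p≢0 = begin
        mult v (combine (μ , ρ))         ≡⟨ mult-sort-++ v ρ (map (_* p) μ) ⟩
        mult v ρ + mult v (map (_* p) μ) ≡⟨ cong₂ _+_ (mult-indivisibles π v%p≢0)
                                                      (mult-scaled-indivisible v%p≢0 μ) ⟩
        mult v π + 0                     ≡⟨ +-identityʳ (mult v π) ⟩
        mult v π                         ∎
      ... | yes v%p≡0 = begin
        mult v (combine (μ , ρ))         ≡⟨ mult-sort-++ v ρ (map (_* p) μ) ⟩
        mult v ρ + mult v (map (_* p) μ) ≡⟨ cong₂ _+_ (mult-indivisibles-divisible π v%p≡0)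
                                                      (cong (λ v → mult v (map (_* p) μ)) (sym v/p*p≡v)) ⟩
        mult (v / p * p) (map (_* p) μ)  ≡⟨ mult-scaled (v / p) μ ⟩
        mult (v / p) μ                   ≡⟨ mult-multiples π⊢n (v / p) ⟩
        mult (v / p * p) π               ≡⟨ cong (λ v → mult v π) v/p*p≡v ⟩
        mult v π                         ∎
        where v/p*p≡v = m%n≡0⇒m/n*n≡m v%p≡0

    divide-splits : ∀ {π} → IsPartition n π → Splits (divide π)
    divide-splits {π} π⊢n =
      ∈-partitionsUpTo⁺ (fromMult-isPartition _ n) (≤-trans (m≤m*n (sum (multiples π)) p) w≤n) , w≤n , ρ⊢ ,
      All⇒allᵇ (indivisibleBy p) {indivisibles π} (all-filter (T? ∘ indivisibleBy p) π)
      where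
      split = remainder-isPartition (subst (IsPartition n) (sym (combine∘divide π⊢n)) π⊢n) (sum-map-* p (multiples π))
                (indivisibles-sorted (sorted π⊢n)) (All.filter⁺ (T? ∘ indivisibleBy p) (positive π⊢n))
      w≤n = proj₁ split
      ρ⊢  = proj₂ split

    combine-isPartition : ∀ {μρ} → Splits μρ → IsPartition n (combine μρ)
    combine-isPartition {μ , ρ} (μ∈ , w≤n , ρ⊢ , _) = join-isPartition ρ⊢
      (All.map⁺ (All.map (λ {x} x>0 → <-≤-trans x>0 (m≤m*n x p)) (positive (proj₁ (∈-partitionsUpTo⁻ {n} μ∈)))))
      (sum-map-* p μ) w≤n

    divide∘combine : ∀ {μρ} → Splits μρ → divide (combine μρ) ≡ μρ
    divide∘combine {μ , ρ} splits@(μ∈ , _ , ρ⊢ , ρ-indiv) = cong₂ _,_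
      (sorted-mult-injective (sorted (fromMult-isPartition _ n)) (sorted (proj₁ (∈-partitionsUpTo⁻ {n} μ∈))) λ u →
        begin
        mult u (multiples π)                          ≡⟨ mult-multiples π⊢n u ⟩
        mult (u * p) π                                ≡⟨ mult-sort-++ (u * p) ρ (map (_* p) μ) ⟩
        mult (u * p) ρ + mult (u * p) (map (_* p) μ)  ≡⟨ cong₂ _+_ (mult-indivisible {ρ = ρ} ρ-indiv (m*n%n≡0 u p))
                                                                   (mult-scaled u μ) ⟩
        mult u μ                                      ∎)
      (sorted-mult-injective (indivisibles-sorted (sorted π⊢n)) (sorted ρ⊢) λ v → case v % p ≟ 0 of λ where
        (yes v%p≡0) → trans (mult-indivisibles-divisible π v%p≡0) (sym (mult-indivisible {ρ = ρ} ρ-indiv v%p≡0))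
        (no v%p≢0) → begin
          mult v (indivisibles π)           ≡⟨ mult-indivisibles π v%p≢0 ⟩
          mult v π                          ≡⟨ mult-sort-++ v ρ (map (_* p) μ) ⟩
          mult v ρ + mult v (map (_* p) μ)  ≡⟨ cong (mult v ρ +_) (mult-scaled-indivisible v%p≢0 μ) ⟩
          mult v ρ + 0                      ≡⟨ +-identityʳ (mult v ρ) ⟩
          mult v ρ                          ∎)
      where
      π = combine (μ , ρ)
      π⊢n = combine-isPartition splits
      open ≡-Reasoning

  indivisible-decomposition : Decomposition (λ _ → true) (weight p) (partitionsUpTo n) (indivisible p) n
  indivisible-decomposition = record
    { split       = divide
    ; join        = combine
    ; split-valid = λ π⊢n _ → divide-splits π⊢n
    ; join-valid  = λ splits → combine-isPartition splits , _
    ; join∘split  = λ π⊢n _ → combine∘divide π⊢n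
    ; split∘join  = divide∘combine }

module _ (p : ℕ) .{{_ : NonZero p}} where

  weight>0 : ∀ {n μ} → μ ∈ concatMap partitions (applyUpTo suc n) → 0 < weight p μ
  weight>0 {n} {μ} μ∈ with t , t∈ , μ∈′ ← find (∈-concatMap⁻ partitions {xs = applyUpTo suc n} μ∈)
                      with i , _ , refl ← ∈-applyUpTo⁻ suc t∈ =
    <-≤-trans (subst (0 <_) (sym (sum≡ (∈-partitions⁻ {suc i} μ∈′))) z<s) (m≤m*n (sum μ) p)

  glaisher : ∀ n → count (multsBelow p) n ≡ count (indivisible p) n
  glaisher = <-rec _ step
    where
    R = multsBelow p
    D = indivisible p

    step : ∀ n → (∀ {m} → m < n → count R m ≡ count D m) → count R n ≡ count D n
    step n IH = +-cancelʳ-≡ (length (splittings (weight p) rest R n)) (count R n) (count D n) (begin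
      count R n + length (splittings (weight p) rest R n)   ≡⟨ length-splittings-∷ (weight p) [] rest R n ⟨
      length (splittings (weight p) (partitionsUpTo n) R n) ≡⟨ count-decomposition (partitionsUpTo-unique n)
                                                                                     (multsBelow-decomposition p n) ⟨
      count (λ _ → true) n                                  ≡⟨ count-decomposition (partitionsUpTo-unique n)
                                                                                     (indivisible-decomposition p n) ⟩
      length (splittings (weight p) (partitionsUpTo n) D n) ≡⟨ length-splittings-∷ (weight p) [] rest D n ⟩
      count D n + length (splittings (weight p) rest D n)   ≡⟨ cong (count D n +_) (length-splittings-cong (weight p) rest n
                                                                 (λ μ∈ w≤n → IH (∸-monoʳ-< (weight>0 {n} μ∈) w≤n))) ⟨
      count D n + length (splittings (weight p) rest R n)   ∎)
      where
      open ≡-Reasoning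
      -- partitionsUpTo n is definitionally [] ∷ rest, and [] has weight 0
      rest = concatMap partitions (applyUpTo suc n)


-- Partitions with exactly one heavy part

∈-deduplicateᵇ⁺ : ∀ {xs z} → z ∈ xs → z ∈ deduplicateᵇ _≡ᵇ_ xs
∈-deduplicateᵇ⁺ = SetoidMembership.∈-deduplicate⁺ (setoid ℕ) (T? ∘₂ _≡ᵇ_)
                    (λ {_} {y} {z} z≡ᵇy x≡y → trans x≡y (sym (≡ᵇ⇒≡ z y z≡ᵇy)))

deduplicate-≡[k]⁻ : ∀ {xs k} → deduplicateᵇ _≡ᵇ_ xs ≡ k ∷ [] → k ∈ xs × All (_≡ k) xs
deduplicate-≡[k]⁻ {y ∷ ys} eq with refl ← ∷-injectiveˡ eq = here refl , refl ∷ All.tabulate y≡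
  where
  rest≡[] = ∷-injectiveʳ eq
  y≡ : ∀ {z} → z ∈ ys → z ≡ y
  y≡ {z} z∈ys with z ≟ y
  ... | yes z≡y = z≡y
  ... | no z≢y = contradiction
        (subst (z ∈_) rest≡[] (∈-filter⁺ _ (∈-deduplicateᵇ⁺ z∈ys) (z≢y ∘ sym ∘ ≡ᵇ⇒≡ y z)))
        λ ()

deduplicate-≡[k]⁺ : ∀ {xs k} → k ∈ xs → All (_≡ k) xs → deduplicateᵇ _≡ᵇ_ xs ≡ k ∷ []
deduplicate-≡[k]⁺ {y ∷ ys} _ (refl ∷ ys≡) =
  cong (y ∷_) (filter-none (¬? ∘ (T? ∘₂ _≡ᵇ_) y) (All.tabulate λ z∈ ¬y≡z →
    ¬y≡z (≡⇒≡ᵇ y _ (sym (All.lookup ys≡ (∈-deduplicate⁻ (T? ∘₂ _≡ᵇ_) ys z∈))))))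

SoleMember : (ℕ → Set) → List ℕ → ℕ → Set
SoleMember P xs k = k ∈ xs × P k × (∀ {y} → y ∈ xs → P y → y ≡ k)

deduplicate-filter-≡[k]⁻ : ∀ P {xs k} → deduplicateᵇ _≡ᵇ_ (filterᵇ P xs) ≡ k ∷ [] →
                           SoleMember (T ∘ P) xs k
deduplicate-filter-≡[k]⁻ P {xs} eq =
  let k∈ , all≡k = deduplicate-≡[k]⁻ eq ; k∈xs , Pk = ∈-filter⁻ (T? ∘ P) k∈ in
  k∈xs , Pk , λ y∈ Py → All.lookup all≡k (∈-filter⁺ (T? ∘ P) y∈ Py)

deduplicate-filter-≡[k]⁺ : ∀ P {xs k} → SoleMember (T ∘ P) xs k →
                           deduplicateᵇ _≡ᵇ_ (filterᵇ P xs) ≡ k ∷ []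
deduplicate-filter-≡[k]⁺ P {xs} (k∈ , Pk , sole) = deduplicate-≡[k]⁺ (∈-filter⁺ (T? ∘ P) k∈ Pk)
  (All.tabulate (λ y∈ → let y∈xs , Py = ∈-filter⁻ (T? ∘ P) y∈ in sole y∈xs Py))

OnlyHeavy : ℕ → List ℕ → ℕ → Set
OnlyHeavy p π k = p ≤ mult k π × (∀ v → p ≤ mult v π → v ≡ k)

heavy≡[k]⁻ : ∀ {p π k} → 0 < p → heavy p π ≡ k ∷ [] → OnlyHeavy p π k
heavy≡[k]⁻ {p} {π} p>0 eq = let _ , p≤k , sole = deduplicate-filter-≡[k]⁻ (λ x → p ≤ᵇ mult x π) eq in
  ≤ᵇ⇒≤ p _ p≤k , λ v p≤v → sole (mult>0⇒∈ v π (<-≤-trans p>0 p≤v)) (≤⇒≤ᵇ p≤v)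

heavy≡[k]⁺ : ∀ {p π k} → 0 < p → OnlyHeavy p π k → heavy p π ≡ k ∷ []
heavy≡[k]⁺ {p} {π} {k} p>0 (p≤k , sole) = deduplicate-filter-≡[k]⁺ (λ x → p ≤ᵇ mult x π)
  (mult>0⇒∈ k π (<-≤-trans p>0 p≤k) , ≤⇒≤ᵇ p≤k , λ {v} _ p≤v → sole v (≤ᵇ⇒≤ p _ p≤v))

gPred⁻ : ∀ {r p π} → T (gPred r p π) → ∃[ k ] (heavy p π ≡ k ∷ [] × k % 2 ≡ r)
gPred⁻ {r} {p} {π} g with heavy p π
... | k ∷ [] = k , refl , ≡ᵇ⇒≡ _ r g

gPred⁺ : ∀ {r p π k} → heavy p π ≡ k ∷ [] → k % 2 ≡ r → T (gPred r p π)
gPred⁺ {r} {p} {π} {k} eq k%2≡r with heavy p π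
gPred⁺ refl k%2≡r | _ = ≡⇒≡ᵇ _ _ k%2≡r

-- (k , a) stands for a·p copies of the heavy part k, or for a copies of the part k·p.
blocks : ℕ → ℕ → List (ℕ × ℕ)
blocks r n = cartesianProduct (filterᵇ (λ k → k % 2 ≡ᵇ r) (applyUpTo suc n)) (applyUpTo suc n)

blockWeight : ℕ → ℕ × ℕ → ℕ
blockWeight p (k , a) = a * (k * p)

∈-applyUpTo-suc⁺ : ∀ {v n} → 0 < v → v ≤ n → v ∈ applyUpTo suc n
∈-applyUpTo-suc⁺ {suc v} _ v<n = ∈-applyUpTo⁺ suc v<n

∈-applyUpTo-suc⁻ : ∀ {v n} → v ∈ applyUpTo suc n → 0 < v
∈-applyUpTo-suc⁻ v∈ with _ , _ , refl ← ∈-applyUpTo⁻ suc v∈ = z<s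

applyUpTo-suc-unique : ∀ n → Unique (applyUpTo suc n)
applyUpTo-suc-unique n = Uniqueₚ.applyUpTo⁺₁ suc n (λ i<j _ → <⇒≢ (s≤s i<j))

∈-blocks⁺ : ∀ {r n k a} → 0 < k → k ≤ n → k % 2 ≡ r → 0 < a → a ≤ n → (k , a) ∈ blocks r n
∈-blocks⁺ {r} k>0 k≤n k%2≡r a>0 a≤n =
  ∈-cartesianProduct⁺ (∈-filter⁺ (T? ∘ (λ k → k % 2 ≡ᵇ r)) (∈-applyUpTo-suc⁺ k>0 k≤n) (≡⇒≡ᵇ _ r k%2≡r))
                      (∈-applyUpTo-suc⁺ a>0 a≤n)

∈-blocks⁻ : ∀ {r n k a} → (k , a) ∈ blocks r n → 0 < k × k % 2 ≡ r × 0 < a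
∈-blocks⁻ {r} {n} ka∈ =
  let k∈ , a∈ = ∈-cartesianProduct⁻ (filterᵇ (λ k → k % 2 ≡ᵇ r) (applyUpTo suc n)) (applyUpTo suc n) ka∈
      k∈′ , k%2≡r = ∈-filter⁻ (T? ∘ (λ k → k % 2 ≡ᵇ r)) {xs = applyUpTo suc n} k∈
  in ∈-applyUpTo-suc⁻ {n = n} k∈′ , ≡ᵇ⇒≡ _ r k%2≡r , ∈-applyUpTo-suc⁻ {n = n} a∈

blocks-unique : ∀ r n → Unique (blocks r n)
blocks-unique r n =
  Uniqueₚ.cartesianProduct⁺ (Uniqueₚ.filter⁺ (T? ∘ (λ k → k % 2 ≡ᵇ r)) (applyUpTo-suc-unique n)) (applyUpTo-suc-unique n)

module _ (p : ℕ) .{{_ : NonZero p}} (r n : ℕ) where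

  private
    Splits : (ℕ × ℕ) × List ℕ → Set
    Splits = IsSplitting (blockWeight p) (blocks r n) (multsBelow p) n

    leftover : ℕ → List ℕ → List ℕ
    leftover k π = addParts (mult k π % p) k (without k π)

    divideAt : ℕ → List ℕ → (ℕ × ℕ) × List ℕ
    divideAt k π = (k , mult k π / p) , leftover k π

    divide : List ℕ → (ℕ × ℕ) × List ℕ
    divide π = divideAt (theElement (heavy p π)) π

    combine : (ℕ × ℕ) × List ℕ → List ℕ
    combine ((k , a) , ν) = addParts (a * p) k ν

    block-sum : ∀ k a → sum (replicate (a * p) k) ≡ blockWeight p (k , a)
    block-sum k a = trans (sum-replicate (a * p) k) (trans (*-assoc a p k) (cong (a *_) (*-comm p k)))

    mult-leftover-self : ∀ k π → mult k (leftover k π) ≡ mult k π % p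
    mult-leftover-self k π =
      trans (mult-addParts-self (mult k π % p) k (without k π)) (cong (_+ mult k π % p) (mult-without-self k π))

    mult-leftover-other : ∀ {v} k π → v ≢ k → mult v (leftover k π) ≡ mult v π
    mult-leftover-other k π v≢k =
      trans (mult-addParts-other (mult k π % p) k (without k π) v≢k) (mult-without-other π v≢k)

    combine∘divideAt : ∀ k {π} → IsPartition n π → combine (divideAt k π) ≡ π
    combine∘divideAt k {π} π⊢n = sorted-mult-injective (sort-↗ _) (sorted π⊢n) mult-eq
      where
      open ≡-Reasoning
      mult-eq : ∀ v → mult v (combine (divideAt k π)) ≡ mult v π
      mult-eq v with v ≟ k
      ... | yes refl = begin
        mult v (addParts (mult v π / p * p) v (leftover v π))  ≡⟨ mult-addParts-self (mult v π / p * p) v (leftover v π) ⟩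
        mult v (leftover v π) + mult v π / p * p               ≡⟨ cong (_+ mult v π / p * p) (mult-leftover-self v π) ⟩
        mult v π % p + mult v π / p * p                        ≡⟨ m≡m%n+[m/n]*n (mult v π) p ⟨
        mult v π                                               ∎
      ... | no v≢k = trans (mult-addParts-other (mult k π / p * p) k (leftover k π) v≢k) (mult-leftover-other k π v≢k)

    divideAt-splits : ∀ {k π} → IsPartition n π → OnlyHeavy p π k → k % 2 ≡ r → Splits (divideAt k π)
    divideAt-splits {k} {π} π⊢n (p≤k , sole) k%2≡r =
      ∈-blocks⁺ k>0 (All.lookup (parts≤ π⊢n) k∈π) k%2≡r a>0 (≤-trans (m≤m*n a (k * p) {{kp≢0}}) w≤n) ,
      w≤n , ν⊢ , multsBelow⁺ {π = leftover k π} below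
      where
      a = mult k π / p
      k∈π = mult>0⇒∈ k π (<-≤-trans (>-nonZero⁻¹ p) p≤k)
      k>0 = All.lookup (positive π⊢n) k∈π
      kp≢0 = m*n≢0 k p {{>-nonZero k>0}}
      a>0 = m≥n⇒m/n>0 p≤k
      split = remainder-isPartition (subst (IsPartition n) (sym (combine∘divideAt k π⊢n)) π⊢n) (block-sum k a)
                (sort-↗ _) (addParts-positive (mult k π % p) (All.filter⁺ _ (positive π⊢n)) k>0)
      w≤n = proj₁ split
      ν⊢  = proj₂ split
      below : ∀ v → mult v (leftover k π) < p
      below v with v ≟ k
      ... | yes refl = subst (_< p) (sym (mult-leftover-self v π)) (m%n<n (mult v π) p)
      ... | no v≢k   = subst (_< p) (sym (mult-leftover-other k π v≢k)) (≰⇒> (v≢k ∘ sole v))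

    combine-isPartition : ∀ {kaν} → Splits kaν → IsPartition n (combine kaν)
    combine-isPartition {(k , a) , ν} (ka∈ , w≤n , ν⊢ , _) =
      join-isPartition ν⊢ (All.replicate⁺ (a * p) (proj₁ (∈-blocks⁻ {r} {n} ka∈))) (block-sum k a) w≤n

    combine-onlyHeavy : ∀ {kaν} → Splits kaν → OnlyHeavy p (combine kaν) (proj₁ (proj₁ kaν))
    combine-onlyHeavy {(k , a) , ν} (ka∈ , _ , _ , ν-below) =
      subst (p ≤_) (sym (mult-addParts-self (a * p) k ν)) (≤-trans (m≤n*m p a {{a≢0}}) (m≤n+m (a * p) (mult k ν))) ,
      λ v p≤v → case v ≟ k of λ where
        (yes v≡k) → v≡k
        (no v≢k) → contradiction (subst (p ≤_) (mult-addParts-other (a * p) k ν v≢k) p≤v)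
                                 (<⇒≱ (multsBelow⁻ {π = ν} ν-below v))
      where a≢0 = >-nonZero (proj₂ (proj₂ (∈-blocks⁻ {r} {n} ka∈)))

    heavy-combine : ∀ {kaν} → Splits kaν → heavy p (combine kaν) ≡ proj₁ (proj₁ kaν) ∷ []
    heavy-combine {kaν} splits = heavy≡[k]⁺ {p} {combine kaν} (>-nonZero⁻¹ p) (combine-onlyHeavy splits)

    divide∘combine : ∀ {kaν} → Splits kaν → divide (combine kaν) ≡ kaν
    divide∘combine {(k , a) , ν} splits@(_ , _ , ν⊢ , ν-below) = begin
      divide π        ≡⟨ cong (λ k′ → divideAt k′ π) (cong theElement (heavy-combine splits)) ⟩
      divideAt k π    ≡⟨ cong₂ (λ a′ ν′ → (k , a′) , ν′) a-eq ν-eq ⟩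
      ((k , a) , ν)   ∎
      where
      open ≡-Reasoning
      π = combine ((k , a) , ν)
      mult-k : mult k π ≡ mult k ν + a * p
      mult-k = mult-addParts-self (a * p) k ν
      k<p = multsBelow⁻ {π = ν} ν-below k
      a-eq : mult k π / p ≡ a
      a-eq = trans (cong (_/ p) mult-k) ([r+q*n]/n≡q a k<p)
      ν-eq : leftover k π ≡ ν
      ν-eq = sorted-mult-injective (sort-↗ _) (sorted ν⊢) λ v → case v ≟ k of λ where
        (yes refl) → trans (mult-leftover-self v π) (trans (cong (_% p) mult-k) ([r+q*n]%n≡r a k<p))
        (no v≢k)   → trans (mult-leftover-other k π v≢k) (mult-addParts-other (a * p) k ν v≢k)

    divide-splits : ∀ {π} → IsPartition n π → T (gPred r p π) → Splits (divide π)
    divide-splits {π} π⊢n g with k , heavy≡ , k%2≡r ← gPred⁻ {r} {p} {π} g =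
      subst (λ k → Splits (divideAt k π)) (sym (cong theElement heavy≡))
        (divideAt-splits π⊢n (heavy≡[k]⁻ {p} {π} (>-nonZero⁻¹ p) heavy≡) k%2≡r)

  heavy-decomposition : Decomposition (gPred r p) (blockWeight p) (blocks r n) (multsBelow p) n
  heavy-decomposition = record
    { split       = divide
    ; join        = combine
    ; split-valid = divide-splits
    ; join-valid  = λ {kaν} splits → combine-isPartition splits ,
                                      gPred⁺ {r} {p} {combine kaν} (heavy-combine splits)
                                             (proj₁ (proj₂ (∈-blocks⁻ {r} {n} (proj₁ splits))))
    ; join∘split  = λ {π} π⊢n _ → combine∘divideAt (theElement (heavy p π)) π⊢n
    ; split∘join  = divide∘combine }


-- Partitions with exactly one part in a residue class

residue : ℕ → ℕ → ℕ → Bool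
residue i p x = mod x (2 * p) ≡ᵇ i

singleton⁻ : ∀ (xs : List ℕ) → T (length xs ≡ᵇ 1) → ∃[ x ] xs ≡ x ∷ []
singleton⁻ (x ∷ []) _ = x , refl

hPred⁻ : ∀ {i p π} → T (hPred i p π) →
         All (λ x → T (indivisibleBy p x ∨ residue i p x)) π × ∃[ x ] SoleMember (T ∘ residue i p) π x
hPred⁻ {i} {p} {π} h =
  let all-ok , single = Equivalence.to T-∧ h
      x , eq = singleton⁻ (deduplicateᵇ _≡ᵇ_ (filterᵇ (residue i p) π)) single
  in allᵇ⇒All _ π all-ok , x , deduplicate-filter-≡[k]⁻ (residue i p) eq

hPred⁺ : ∀ {i p π x} → All (λ x → T (indivisibleBy p x ∨ residue i p x)) π →
         SoleMember (T ∘ residue i p) π x → T (hPred i p π)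
hPred⁺ {i} {p} {π} all-ok sole = Equivalence.from T-∧
  (All⇒allᵇ _ all-ok , subst (λ ys → T (length ys ≡ᵇ 1)) (sym (deduplicate-filter-≡[k]⁺ (residue i p) sole)) _)

addParts-without : ∀ {n} x {π} → IsPartition n π → addParts (mult x π) x (without x π) ≡ π
addParts-without x {π} π⊢n = sorted-mult-injective (sort-↗ _) (sorted π⊢n) λ v → case v ≟ x of λ where
  (yes refl) → trans (mult-addParts-self (mult v π) v (without v π)) (cong (_+ mult v π) (mult-without-self v π))
  (no v≢x)   → trans (mult-addParts-other (mult x π) x (without x π) v≢x) (mult-without-other π v≢x)

module _ (p : ℕ) .{{_ : NonZero p}} where

  private instance
    2p≢0 : NonZero (2 * p)
    2p≢0 = m*n≢0 2 p

  residue⁺ : ∀ {i x} → x % (2 * p) ≡ i → T (residue i p x)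
  residue⁺ {i} {x} eq = ≡⇒≡ᵇ _ i (trans (mod≡% x (2 * p)) eq)

  residue⁻ : ∀ {i x} → T (residue i p x) → x % (2 * p) ≡ i
  residue⁻ {i} {x} res = trans (sym (mod≡% x (2 * p))) (≡ᵇ⇒≡ _ i res)

  residue-multiple : ∀ k → (k * p) % (2 * p) ≡ k % 2 * p
  residue-multiple k = sym (m%n*o≡m*o%[n*o] k 2 p)

  residue-multiple⁺ : ∀ r {k} → k % 2 ≡ r → T (residue (r * p) p (k * p))
  residue-multiple⁺ r {k} k%2≡r = residue⁺ (trans (residue-multiple k) (cong (_* p) k%2≡r))

  residue⇒divisible : ∀ r {x} → T (residue (r * p) p x) → x % p ≡ 0
  residue⇒divisible r {x} res = begin
    x % p               ≡⟨ m∣n⇒o%n%m≡o%m p (2 * p) x (n∣m*n 2) ⟨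
    x % (2 * p) % p     ≡⟨ cong (_% p) (residue⁻ res) ⟩
    r * p % p           ≡⟨ m*n%n≡0 r p ⟩
    0                   ∎
    where open ≡-Reasoning

  residue⇒parity : ∀ r {x} → T (residue (r * p) p x) → x / p % 2 ≡ r
  residue⇒parity r {x} res = *-cancelʳ-≡ (x / p % 2) r p (begin
    x / p % 2 * p            ≡⟨ residue-multiple (x / p) ⟨
    (x / p * p) % (2 * p)    ≡⟨ cong (_% (2 * p)) (m%n≡0⇒m/n*n≡m (residue⇒divisible r res)) ⟩
    x % (2 * p)              ≡⟨ residue⁻ res ⟩
    r * p                    ∎)
    where open ≡-Reasoning

module _ (p : ℕ) .{{_ : NonZero p}} (r n : ℕ) where

  private
    Splits : (ℕ × ℕ) × List ℕ → Set
    Splits = IsSplitting (blockWeight p) (blocks r n) (indivisible p) n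

    Residue : ℕ → Set
    Residue x = T (residue (r * p) p x)

    Admissible : ℕ → Set
    Admissible x = T (indivisibleBy p x ∨ residue (r * p) p x)

    divideAt : ℕ → List ℕ → (ℕ × ℕ) × List ℕ
    divideAt x π = (x / p , mult x π) , without x π

    divide : List ℕ → (ℕ × ℕ) × List ℕ
    divide π = divideAt (theElement (deduplicateᵇ _≡ᵇ_ (filterᵇ (residue (r * p) p) π))) π

    combine : (ℕ × ℕ) × List ℕ → List ℕ
    combine ((k , a) , ν) = addParts a (k * p) ν

    combine∘divideAt : ∀ {x π} → x / p * p ≡ x → IsPartition n π → combine (divideAt x π) ≡ π
    combine∘divideAt {x} {π} kp≡x π⊢n =
      trans (cong (λ y → addParts (mult x π) y (without x π)) kp≡x) (addParts-without x π⊢n)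

    divide≡divideAt : ∀ {π x} → SoleMember Residue π x → divide π ≡ divideAt x π
    divide≡divideAt {π} sole =
      cong (λ x → divideAt x π) (cong theElement (deduplicate-filter-≡[k]⁺ (residue (r * p) p) sole))

    divideAt-splits : ∀ {x π} → IsPartition n π → All Admissible π → SoleMember Residue π x →
                      Splits (divideAt x π)
    divideAt-splits {x} {π} π⊢n admissible (x∈π , x-res , sole) =
      ∈-blocks⁺ k>0 (≤-trans (m≤m*n k p) (subst (_≤ n) (sym kp≡x) x≤n)) k%2≡r a>0
                (≤-trans (m≤m*n a (k * p) {{>-nonZero kp>0}}) w≤n) ,
      w≤n , ν⊢ , All⇒allᵇ (indivisibleBy p) (All.tabulate ν-indivisible)
      where
      k = x / p
      a = mult x π
      ν = without x π
      kp≡x = m%n≡0⇒m/n*n≡m (residue⇒divisible p r x-res)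
      k%2≡r = residue⇒parity p r x-res
      x≤n = All.lookup (parts≤ π⊢n) x∈π
      kp>0 = subst (0 <_) (sym kp≡x) (All.lookup (positive π⊢n) x∈π)
      k>0 : 0 < k
      k>0 = n≢0⇒n>0 (λ k≡0 → <⇒≢ kp>0 (sym (cong (_* p) k≡0)))
      a>0 = ∈⇒mult>0 x∈π
      split = remainder-isPartition (subst (IsPartition n) (sym (combine∘divideAt kp≡x π⊢n)) π⊢n)
                (sum-replicate a (k * p)) (without-sorted x (sorted π⊢n)) (All.filter⁺ _ (positive π⊢n))
      w≤n = proj₁ split
      ν⊢  = proj₂ split
      ν-indivisible : ∀ {y} → y ∈ ν → T (indivisibleBy p y)
      ν-indivisible y∈ν with y∈π , y≢x ← ∈-filter⁻ (T? ∘ (λ y → not (y ≡ᵇ x))) {xs = π} y∈ν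
        with Equivalence.to T-∨ (All.lookup admissible y∈π)
      ... | inj₁ y-indiv = y-indiv
      ... | inj₂ y-res = contradiction (≡⇒≡ᵇ _ x (sole y∈π y-res)) (T-not⁻ y≢x)

    combine-isPartition : ∀ {kaν} → Splits kaν → IsPartition n (combine kaν)
    combine-isPartition {(k , a) , ν} (ka∈ , w≤n , ν⊢ , _) =
      join-isPartition ν⊢ (All.replicate⁺ a (<-≤-trans (proj₁ (∈-blocks⁻ {r} {n} ka∈)) (m≤m*n k p)))
                          (sum-replicate a (k * p)) w≤n

    combine-sole : ∀ {kaν} → Splits kaν → SoleMember Residue (combine kaν) (proj₁ (proj₁ kaν) * p)
    combine-sole {(k , a) , ν} (ka∈ , _ , _ , ν-indiv) =
      mult>0⇒∈ (k * p) (combine ((k , a) , ν))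
        (subst (0 <_) (sym (mult-addParts-self a (k * p) ν))
               (<-≤-trans (proj₂ (proj₂ (∈-blocks⁻ {r} {n} ka∈))) (m≤n+m a _))) ,
      residue-multiple⁺ p r {k} (proj₁ (proj₂ (∈-blocks⁻ {r} {n} ka∈))) ,
      λ {y} y∈ y-res → case y ≟ k * p of λ where
        (yes y≡kp) → y≡kp
        (no y≢kp) → contradiction
          (mult>0⇒∈ y ν (subst (0 <_) (mult-addParts-other a (k * p) ν y≢kp) (∈⇒mult>0 y∈)))
          (λ y∈ν → indivisible⁻ {π = ν} ν-indiv y∈ν (residue⇒divisible p r y-res))

    combine-admissible : ∀ {kaν} → Splits kaν → All Admissible (combine kaν)
    combine-admissible {(k , a) , ν} (ka∈ , _ , _ , ν-indiv) =
      All-resp-↭ (↭-sym (sort-↭ (ν ++ replicate a (k * p))))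
        (All.++⁺ (All.map (λ indiv → Equivalence.from T-∨ (inj₁ indiv)) (allᵇ⇒All _ ν ν-indiv))
                 (All.replicate⁺ a (Equivalence.from T-∨ (inj₂ kp-residue))))
      where kp-residue = residue-multiple⁺ p r {k} (proj₁ (proj₂ (∈-blocks⁻ {r} {n} ka∈)))

    divide∘combine : ∀ {kaν} → Splits kaν → divide (combine kaν) ≡ kaν
    divide∘combine {(k , a) , ν} splits@(_ , _ , ν⊢ , ν-indiv) = begin
      divide π              ≡⟨ divide≡divideAt (combine-sole splits) ⟩
      divideAt (k * p) π    ≡⟨ cong₂ (λ k′ (aν : ℕ × List ℕ) → (k′ , proj₁ aν) , proj₂ aν)
                                      (m*n/n≡m k p) (cong₂ _,_ a-eq ν-eq) ⟩
      ((k , a) , ν)         ∎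
      where
      open ≡-Reasoning
      π = combine ((k , a) , ν)
      kp∉ν : mult (k * p) ν ≡ 0
      kp∉ν = mult-indivisible {ρ = ν} ν-indiv (m*n%n≡0 k p)
      a-eq : mult (k * p) π ≡ a
      a-eq = trans (mult-addParts-self a (k * p) ν) (cong (_+ a) kp∉ν)
      ν-eq : without (k * p) π ≡ ν
      ν-eq = sorted-mult-injective (without-sorted (k * p) (sorted (combine-isPartition splits))) (sorted ν⊢) λ v →
        case v ≟ k * p of λ where
        (yes refl) → trans (mult-without-self v π) (sym kp∉ν)
        (no v≢kp)  → trans (mult-without-other π v≢kp) (mult-addParts-other a (k * p) ν v≢kp)

    divide-splits : ∀ {π} → IsPartition n π → T (hPred (r * p) p π) → Splits (divide π)
    divide-splits {π} π⊢n h with admissible , x , sole ← hPred⁻ {r * p} {p} {π} h =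
      subst Splits (sym (divide≡divideAt sole)) (divideAt-splits π⊢n admissible sole)

    combine∘divide : ∀ {π} → IsPartition n π → T (hPred (r * p) p π) → combine (divide π) ≡ π
    combine∘divide {π} π⊢n h with _ , x , sole@(_ , x-res , _) ← hPred⁻ {r * p} {p} {π} h =
      trans (cong combine (divide≡divideAt sole))
            (combine∘divideAt (m%n≡0⇒m/n*n≡m (residue⇒divisible p r x-res)) π⊢n)

  residue-decomposition : Decomposition (hPred (r * p) p) (blockWeight p) (blocks r n) (indivisible p) n
  residue-decomposition = record
    { split       = divide
    ; join        = combine
    ; split-valid = divide-splits
    ; join-valid  = λ {kaν} splits → combine-isPartition splits ,
                                      hPred⁺ {r * p} {p} {combine kaν} (combine-admissible splits) (combine-sole splits)
    ; join∘split  = combine∘divide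
    ; split∘join  = divide∘combine }

count-heavy≡count-residue : ∀ p .{{_ : NonZero p}} r n → count (gPred r p) n ≡ count (hPred (r * p) p) n
count-heavy≡count-residue p r n = begin
  count (gPred r p) n                          ≡⟨ count-decomposition (blocks-unique r n) (heavy-decomposition p r n) ⟩
  length (splittings w (blocks r n) R n)       ≡⟨ length-splittings-cong w (blocks r n) n (λ {i} _ _ → glaisher p (n ∸ w i)) ⟩
  length (splittings w (blocks r n) D n)       ≡⟨ count-decomposition (blocks-unique r n) (residue-decomposition p r n) ⟨
  count (hPred (r * p) p) n                    ∎
  where
  open ≡-Reasoning
  w = blockWeight p
  R = multsBelow p
  D = indivisible p

proposition1 : (p : ℕ) → 1 ≤ p → (n : ℕ) →
    (g-o n p ≡ h p n p) × (g-e n p ≡ h 0 n p)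
proposition1 p p≥1 n =
  trans (count-heavy≡count-residue p 1 n) (cong (λ i → count (hPred i p) n) (*-identityˡ p)) ,
  count-heavy≡count-residue p 0 n
  where instance _ = >-nonZero p≥1
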